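{- Let $\mathcal T\in\Sigma^n$ be a text and let $u$ be an explicit node of the suffix tree of $\mathcal T$ with path label $\alpha$. Then $\alpha$ is a suffix of $\mathcal T[1,j]$ for at least one $j\in\mathtt{st\text{ - }lex}$.
   Context: A text is a string $\mathcal T\in\Sigma^n$ (1-indexed) whose last symbol $\mathcal T[n]=\$$ occurs only there and is smaller than all other symbols; $\mathcal T[1,0]$ is the empty string. Explicit suffix tree nodes are the root, internal (branching) nodes and leaves of the suffix tree; the path label of a node is the concatenation of edge labels from the root. $\mathrm{ISA}[i]$ is the lexicographic rank of $\mathcal T[i,n]$ among all suffixes. $\mathrm{rlce}(i,j)$ is the length of the longest common prefix of $\mathcal T[i,n]$, $\mathcal T[j,n]$. For a permutation $\pi$ of $[n]$: $\mathrm{LPF}_\pi[i]=0$ if $\pi(i)=1$, else $\max_{j:\pi(j)<\pi(i)}\mathrm{rlce}(j,i)$; $\mathrm{PDA}_\pi=\{i+\mathrm{LPF}_\pi[i]:i\in[n]\}$. Let $\mathtt{st\text{ - }lex}^-=\mathrm{PDA}_\pi$ for $\pi(i)=\mathrm{ISA}[i]$ and $\mathtt{st\text{ - }lex}^+=\mathrm{PDA}_{\bar\pi}$ for $\bar\pi(i)=n-\mathrm{ISA}[i]+1$, and $\mathtt{st\text{ - }lex}=\{i-1: i\in\mathtt{st\text{ - }lex}^-\cup\mathtt{st\text{ - }lex}^+\cup\{n+1\}\}\subseteq\{0,\dots,n\}$. -}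

module Defs where

open import Data.Nat using (ℕ; zero; suc; _+_; _∸_; _<_; _≤_; _⊔_)
import Data.Nat as N
open import Data.List using (List; []; _∷_; _++_; [_]; length; drop; take; upTo; filter; map; foldr)
open import Data.List.Membership.Propositional using (_∈_; _∉_)
open import Data.List.Relation.Binary.Pointwise using (Pointwise)
open import Data.List.Relation.Binary.Lex.Strict using (Lex-<; <-decidable)
open import Data.Product using (Σ; ∃; ∃-syntax; _×_; _,_)
open import Data.Sum using (_⊎_)
open import Data.List.Relation.Binary.Pointwise as PW using ()
open import Relation.Binary.PropositionalEquality using (_≡_; _≢_)
open import Relation.Binary.Structures using (IsStrictTotalOrder)
open import Relation.Nullary using (yes; no; ¬_)
open import Relation.Nullary.Decidable using (⌊_⌋)

module Text {A : Set} {_≺_ : A → A → Set}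
            (sto : IsStrictTotalOrder _≡_ _≺_) where

  open IsStrictTotalOrder sto using (_≟_; _<?_)

  IsText : List A → Set
  IsText T = Σ (List A) λ w → Σ A λ d →
               (T ≡ w ++ [ d ]) × (d ∉ w) × (∀ {x} → x ∈ w → d ≺ x)

  module _ (T : List A) where

    n : ℕ
    n = length T

    -- T[i,n] for 1-indexed i (meaningful for 1 ≤ i ≤ n)
    suf : ℕ → List A
    suf i = drop (i ∸ 1) T

    pre : ℕ → List A
    pre j = take j T

    _<lex_ : List A → List A → Set
    _<lex_ = Lex-< _≡_ _≺_

    lcp : List A → List A → ℕ
    lcp [] _ = 0
    lcp (_ ∷ _) [] = 0
    lcp (x ∷ xs) (y ∷ ys) with x ≟ y
    ... | yes _ = suc (lcp xs ys)
    ... | no _  = 0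

    rlce : ℕ → ℕ → ℕ
    rlce i j = lcp (suf i) (suf j)

    positions : List ℕ
    positions = map suc (upTo n)

    ISA : ℕ → ℕ
    ISA i = suc (length (filter (λ j → <-decidable _≟_ _<?_ (suf j) (suf i)) positions))

    maxList : List ℕ → ℕ
    maxList = foldr _⊔_ 0

    LPF : (ℕ → ℕ) → ℕ → ℕ
    LPF π i with π i N.≟ 1
    ... | yes _ = 0
    ... | no _  = maxList (map (λ j → rlce j i)
                             (filter (λ j → π j N.<? π i) positions))

    PDA : (ℕ → ℕ) → ℕ → Set
    PDA π x = Σ ℕ λ i → (1 ≤ i) × (i ≤ n) × (x ≡ i + LPF π i)

    πlex : ℕ → ℕ
    πlex i = ISA i

    πlexbar : ℕ → ℕ
    πlexbar i = n + 1 ∸ ISA i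

    st-lex⁻ : ℕ → Set
    st-lex⁻ = PDA πlex

    st-lex⁺ : ℕ → Set
    st-lex⁺ = PDA πlexbar

    st-lex : ℕ → Set
    st-lex j = st-lex⁻ (suc j) ⊎ st-lex⁺ (suc j) ⊎ (suc j ≡ n + 1)

    IsSuffixOf : List A → List A → Set
    IsSuffixOf α β = Σ (List A) λ γ → γ ++ α ≡ β

    -- Path labels of explicit suffix-tree nodes of T:
    --  * root: the empty string;
    --  * leaves: the suffixes T[i,n], 1 ≤ i ≤ n ($ is unique, so every
    --    suffix ends at a leaf);
    --  * internal (branching) nodes: strings α having two occurrences in T
    --    followed by distinct symbols (right-maximal substrings).
    data ExplicitNodeLabel : List A → Set where
      root     : ExplicitNodeLabel []
      leaf     : ∀ i → 1 ≤ i → i ≤ n → ExplicitNodeLabel (suf i)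
      internal : ∀ α c d → c ≢ d →
                 (Σ (List A) λ β → Σ (List A) λ γ → β ++ α ++ c ∷ γ ≡ T) →
                 (Σ (List A) λ β → Σ (List A) λ γ → β ++ α ++ d ∷ γ ≡ T) →
                 ExplicitNodeLabel α

-- An internal node α has occurrences αc and αd in T with c ≺ d.  Among the
-- suffixes starting with αd take one, T[i,n], whose LPF value (with respect
-- to lexicographic rank) is at most |α|: starting anywhere, while LPF[i] > |α|
-- the lexicographically smaller suffix realising LPF[i] again starts with αd,
-- and the rank strictly decreases.  The suffix starting with αc is smaller
-- than T[i,n] and agrees with it on |α| symbols, so LPF[i] = |α| exactly.
-- Hence i + |α| ∈ st-lex⁻, and T[1, i - 1 + |α|] ends with α.  Root and
-- leaves are suffixes of T = T[1,n], and n ∈ st-lex by definition.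
module Submission where

open import Defs
open import Data.List using (List; []; _∷_; _++_; length; drop; take; filter; map; foldr)
open import Data.List.Properties using (++-identityʳ; take++drop≡id; take-all)
open import Data.List.Membership.Propositional using (_∈_)
open import Data.List.Membership.Propositional.Properties
  using (∈-map⁺; ∈-map⁻; ∈-upTo⁺; ∈-upTo⁻; ∈-filter⁺; ∈-filter⁻; ∈-map∘filter⁺; ∈-map∘filter⁻; foldr-selective)
open import Data.List.Relation.Unary.Any using (here; there)
open import Data.List.Relation.Binary.Pointwise using (Pointwise-≡⇒≡)
open import Data.List.Relation.Binary.Sublist.Propositional using (_⊆_; ⊆-refl)
open import Data.List.Relation.Binary.Sublist.Propositional.Properties using (filter⁺; length-mono-≤; to-≋)
open import Data.List.Relation.Binary.Lex.Core using (this; next)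
open import Data.List.Relation.Binary.Lex.Strict using () renaming (<-isStrictTotalOrder to Lex-<-isStrictTotalOrder)
open import Data.Nat using (ℕ; zero; suc; _+_; _∸_; _<_; _≤_; _⊔_; z≤n; s≤s; _≤?_)
import Data.Nat as ℕ
open import Data.Nat.Induction using (<-wellFounded)
open import Data.Nat.Properties
  using (≤-refl; ≤-trans; ≤-antisym; ≤∧≢⇒<; ≰⇒>; <⇒≱; n≮0; ⊔-sel; m≤m⊔n; m≤n⊔m; +-comm)
open import Data.Product using (Σ; ∃; _×_; _,_; proj₂)
open import Data.Sum using (inj₁; inj₂)
open import Induction.WellFounded using (Acc; acc)
open import Relation.Binary.Definitions using (tri<; tri≈; tri>)
open import Relation.Binary.PropositionalEquality using (_≡_; refl; sym; trans; cong; subst; subst₂)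
open import Relation.Binary.Structures using (IsStrictTotalOrder)
open import Relation.Nullary using (¬_; yes; no; contradiction)
open import Relation.Unary using (Decidable)

module _ {A : Set} where

  length-filter-< : {P Q : A → Set} (P? : Decidable P) (Q? : Decidable Q) →
                    (∀ {x} → P x → Q x) → ∀ {x xs} → x ∈ xs → Q x → ¬ P x →
                    length (filter P? xs) < length (filter Q? xs)
  length-filter-< P? Q? P⇒Q {x} {xs} x∈xs Qx ¬Px =
    ≤∧≢⇒< (length-mono-≤ sub) λ same-length →
      ¬Px (proj₂ (∈-filter⁻ P? {xs = xs} (x∈P-list same-length)))
    where
    sub : filter P? xs ⊆ filter Q? xs
    sub = filter⁺ P? Q? {as = xs} {bs = xs} (λ { refl → P⇒Q }) ⊆-refl
    x∈P-list : length (filter P? xs) ≡ length (filter Q? xs) → x ∈ filter P? xs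
    x∈P-list same-length =
      subst (x ∈_) (sym (Pointwise-≡⇒≡ (to-≋ same-length sub))) (∈-filter⁺ Q? x∈xs Qx)

  take-length-++ : (α ys : List A) → take (length α) (α ++ ys) ≡ α
  take-length-++ []      ys = refl
  take-length-++ (a ∷ α) ys = cong (a ∷_) (take-length-++ α ys)

  take-+-length : ∀ i (xs α ys : List A) → drop i xs ≡ α ++ ys →
                  take (i + length α) xs ≡ take i xs ++ α
  take-+-length zero    xs       α       ys refl = take-length-++ α ys
  take-+-length (suc i) []       []      ys _    = refl
  take-+-length (suc i) (x ∷ xs) α       ys eq   = cong (x ∷_) (take-+-length i xs α ys eq)

  length-<-++-∷ : (β α : List A) {c : A} {γ : List A} → length β < length (β ++ α ++ c ∷ γ)
  length-<-++-∷ []      []      = s≤s z≤n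
  length-<-++-∷ []      (a ∷ α) = s≤s z≤n
  length-<-++-∷ (b ∷ β) α       = s≤s (length-<-++-∷ β α)

≤-maxList : ∀ {x xs} → x ∈ xs → x ≤ foldr _⊔_ 0 xs
≤-maxList {xs = y ∷ ys} (here refl) = m≤m⊔n y _
≤-maxList {xs = y ∷ ys} (there x∈ys) = ≤-trans (≤-maxList x∈ys) (m≤n⊔m y _)

module _ {A : Set} {_≺_ : A → A → Set} (sto : IsStrictTotalOrder _≡_ _≺_) (T : List A) where
  open Text sto
  open IsStrictTotalOrder sto using (_≟_)
  private module Lex = IsStrictTotalOrder (Lex-<-isStrictTotalOrder sto)

  lcp-++ : ∀ α xs ys → length α ≤ lcp T (α ++ xs) (α ++ ys)
  lcp-++ []      xs ys = z≤n
  lcp-++ (a ∷ α) xs ys with a ≟ a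
  ... | yes _  = s≤s (lcp-++ α xs ys)
  ... | no a≢a = contradiction refl a≢a

  lcp-∷-prefix : ∀ α d γ xs → length α < lcp T xs (α ++ d ∷ γ) →
                 ∃ λ γ′ → xs ≡ α ++ d ∷ γ′
  lcp-∷-prefix []      d γ (x ∷ xs) lt with x ≟ d
  ... | yes refl = xs , refl
  lcp-∷-prefix (a ∷ α) d γ (x ∷ xs) lt with x ≟ a
  ... | yes refl with γ′ , eq ← lcp-∷-prefix α d γ xs (ℕ.s≤s⁻¹ lt) = γ′ , cong (x ∷_) eq

  <lex-++-∷ : ∀ α {c d} γ δ → c ≺ d → _<lex_ T (α ++ c ∷ γ) (α ++ d ∷ δ)
  <lex-++-∷ []      γ δ c≺d = this c≺d
  <lex-++-∷ (a ∷ α) γ δ c≺d = next refl (<lex-++-∷ α γ δ c≺d)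

  ISA-mono-< : ∀ {i j} → j ∈ positions T → _<lex_ T (suf T j) (suf T i) → ISA T j < ISA T i
  ISA-mono-< {i} {j} j∈ j<i =
    s≤s (length-filter-< _ _ (λ k<j → Lex.trans k<j j<i) j∈ j<i (Lex.irrefl Lex.Eq.refl))

  LPF-attained : ∀ π i → 0 < LPF T π i →
                 ∃ λ j → j ∈ positions T × π j < π i × rlce T j i ≡ LPF T π i
  LPF-attained π i LPF>0 with π i ℕ.≟ 1
  ... | yes _ = contradiction LPF>0 n≮0
  ... | no  _
    with foldr-selective ⊔-sel 0 (map (λ j → rlce T j i) (filter (λ j → π j ℕ.<? π i) (positions T)))
  ...   | inj₁ max≡0 = contradiction (subst (0 <_) max≡0 LPF>0) n≮0
  ...   | inj₂ max∈
    with j , j∈ , eq , πj<πi ← ∈-map∘filter⁻ (λ j → rlce T j i) (λ j → π j ℕ.<? π i) {xs = positions T} max∈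
    = j , j∈ , πj<πi , sym eq

  LPF-lowerBound : ∀ π {i j} → j ∈ positions T → 0 < π j → π j < π i → rlce T j i ≤ LPF T π i
  LPF-lowerBound π {i} {j} j∈ πj>0 πj<πi with π i ℕ.≟ 1
  ... | yes πi≡1 = contradiction (ℕ.s≤s⁻¹ (subst (π j <_) πi≡1 πj<πi)) (<⇒≱ πj>0)
  ... | no  _    =
    ≤-maxList (∈-map∘filter⁺ (λ k → rlce T k i) (λ k → π k ℕ.<? π i) {xs = positions T} (j , j∈ , refl , πj<πi))

  OccursAt : List A → A → ℕ → Set
  OccursAt α c i = i ∈ positions T × ∃ λ γ → suf T i ≡ α ++ c ∷ γ

  occurrence : ∀ α c → (Σ (List A) λ β → Σ (List A) λ γ → β ++ α ++ c ∷ γ ≡ T) →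
               ∃ (OccursAt α c)
  occurrence α c (β , γ , refl) =
    suc (length β) , ∈-map⁺ suc (∈-upTo⁺ (length-<-++-∷ β α)) , γ , drop-length β
    where
    drop-length : ∀ β → drop (length β) (β ++ α ++ c ∷ γ) ≡ α ++ c ∷ γ
    drop-length []      = refl
    drop-length (_ ∷ β) = drop-length β

  small-LPF-occurrence : ∀ π α d {i} → Acc _<_ (π i) → OccursAt α d i →
                         ∃ λ i′ → OccursAt α d i′ × LPF T π i′ ≤ length α
  small-LPF-occurrence π α d {i} (acc smaller) occ@(_ , γ , suf≡) with LPF T π i ≤? length α
  ... | yes LPF≤α = i , occ , LPF≤α
  ... | no  LPF≰α with ≰⇒> LPF≰α
  ...   | α<LPF with j , j∈ , πj<πi , rlce≡LPF ← LPF-attained π i (≤-trans (s≤s z≤n) α<LPF) =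
    small-LPF-occurrence π α d (smaller πj<πi) (j∈ , lcp-∷-prefix α d γ (suf T j) α<rlce)
    where
    α<rlce : length α < lcp T (suf T j) (α ++ d ∷ γ)
    α<rlce = subst (λ s → length α < lcp T (suf T j) s) suf≡
                   (subst (length α <_) (sym rlce≡LPF) α<LPF)

  suffix-of-pre : ∀ i α ys → suf T (suc i) ≡ α ++ ys → IsSuffixOf T α (pre T (i + length α))
  suffix-of-pre i α ys suf≡ = take i T , sym (take-+-length i T α ys suf≡)

  PDA-endpoint : ∀ π {i} α ys → i ∈ positions T → suf T i ≡ α ++ ys → LPF T π i ≡ length α →
                 Σ ℕ λ j → PDA T π (suc j) × IsSuffixOf T α (pre T j)
  PDA-endpoint π α ys i∈ suf≡ LPF≡α with k , k∈ , refl ← ∈-map⁻ suc i∈ =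
    k + length α ,
    (suc k , s≤s z≤n , ∈-upTo⁻ k∈ , cong (suc k +_) (sym LPF≡α)) ,
    suffix-of-pre k α ys suf≡

  LPF-lex-lowerBound : ∀ α {c d} γ δ {i j} → c ≺ d → j ∈ positions T →
                    suf T j ≡ α ++ c ∷ γ → suf T i ≡ α ++ d ∷ δ → length α ≤ LPF T (πlex T) i
  LPF-lex-lowerBound α {c} {d} γ δ {i} c≺d j∈ sufj≡ sufi≡ = ≤-trans
    (subst₂ (λ s t → length α ≤ lcp T s t) (sym sufj≡) (sym sufi≡) (lcp-++ α (c ∷ γ) (d ∷ δ)))
    (LPF-lowerBound (πlex T) {i} j∈ (s≤s z≤n)
      (ISA-mono-< {i} j∈ (subst₂ (_<lex_ T) (sym sufj≡) (sym sufi≡) (<lex-++-∷ α γ δ c≺d))))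

  branching-node-witness : ∀ α {c d} → c ≺ d → ∃ (OccursAt α c) → ∃ (OccursAt α d) →
                          Σ ℕ λ j → st-lex T j × IsSuffixOf T α (pre T j)
  branching-node-witness α {c} {d} c≺d (j , j∈ , γ , sufj≡) (i₀ , occ₀)
    with i , (i∈ , δ , sufi≡) , LPF≤α ← small-LPF-occurrence (πlex T) α d (<-wellFounded (ISA T i₀)) occ₀
    with k , pda , suffix ← PDA-endpoint (πlex T) α (d ∷ δ) i∈ sufi≡
                              (≤-antisym LPF≤α (LPF-lex-lowerBound α γ δ c≺d j∈ sufj≡ sufi≡))
    = k , inj₁ pda , suffix

  n∈st-lex : st-lex T (n T)
  n∈st-lex = inj₂ (inj₂ (+-comm 1 (n T)))

  suf-suffix-of-text : ∀ i → IsSuffixOf T (suf T i) (pre T (n T))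
  suf-suffix-of-text i =
    take (i ∸ 1) T , trans (take++drop≡id (i ∸ 1) T) (sym (take-all (n T) T ≤-refl))

corollary20 : {A : Set} {_≺_ : A → A → Set}
    (sto : IsStrictTotalOrder _≡_ _≺_) (T : List A) →
    Text.IsText sto T →
    (α : List A) → Text.ExplicitNodeLabel sto T α →
    Σ ℕ λ j → Text.st-lex sto T j × Text.IsSuffixOf sto T α (Text.pre sto T j)
corollary20 sto T _ .[] Text.root = length T , n∈st-lex sto T , (take (length T) T , ++-identityʳ _)
corollary20 sto T _ _ (Text.leaf i _ _) = length T , n∈st-lex sto T , suf-suffix-of-text sto T i
corollary20 sto T _ α (Text.internal .α c d c≢d occ-c occ-d) with IsStrictTotalOrder.compare sto c d
... | tri< c≺d _ _ = branching-node-witness sto T α c≺d (occurrence sto T α c occ-c)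
                                                      (occurrence sto T α d occ-d)
... | tri≈ _ c≡d _ = contradiction c≡d c≢d
... | tri> _ _ d≺c = branching-node-witness sto T α d≺c (occurrence sto T α d occ-d)
                                                      (occurrence sto T α c occ-c)
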